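{- Let $O_i=[\varphi_i]=\{w\in\Omega_c\mid\varphi_i\in w\}$ for $i\in\mathbb{N}$. Then $\langle\Omega_c,\tau_c,(O_i)_{i\in\mathbb{N}}\rangle$ is a computable topological space, i.e. there is a total computable function $g:\mathbb{N}^3\to\mathbb{N}$ such that $O_i\cap O_j=\bigcup_{k\in\mathbb{N}}O_{g(i,j,k)}$ for all $i,j\in\mathbb{N}$.
   Context: Let $\mathbb{P}$ be a countable set of propositional variables. The formulas of $\mathcal{L}_{\mathsf{DPL}}$ are given by $\varphi ::= p \mid \neg\varphi \mid \varphi\wedge\varphi \mid L_r\varphi \mid \bigcirc\varphi$ with $p\in\mathbb{P}$, $r\in\mathbb{Q}\cap[0,1]$; $\bigcirc^n$ is iteration, $L_{r_1}\cdots L_{r_k}L_s\varphi$ iterated application. Fix a standard effective Gödel numbering bijecting formulas onto a computable set $Form\subseteq\mathbb{N}$; $\varphi_n$ is the formula whose Gödel number is the $n$-th element of $Form$. The Hilbert system $\mathcal{H}_{\mathsf{DPL}}$ has axiom schemes: propositional tautologies; $L_0\bot$; $L_r\neg\varphi\to\neg L_s\varphi$ if $r+s>1$; $L_r(\varphi\wedge\psi)\wedge L_s(\varphi\wedge\neg\psi)\to L_{r+s}\varphi$ if $r+s\le 1$; $\neg L_r(\varphi\wedge\psi)\wedge\neg L_s(\varphi\wedge\neg\psi)\to\neg L_{r+s}\varphi$ if $r+s\le1$; $L_1(\varphi\to\psi)\to(L_r\varphi\to L_r\psi)$; $\bigcirc\neg\varphi\leftrightarrow\neg\bigcirc\varphi$;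 $\bigcirc(\varphi\wedge\psi)\leftrightarrow(\bigcirc\varphi\wedge\bigcirc\psi)$; rules: modus ponens; from $\{\psi\to\bigcirc^nL_{r_1}\cdots L_{r_k}L_s\varphi\mid s<r\}$ infer $\psi\to\bigcirc^nL_{r_1}\cdots L_{r_k}L_r\varphi$; from $\varphi$ infer $L_1\varphi$; from $\varphi$ infer $\bigcirc\varphi$ (derivations of countable ordinal length; derivations from premises may not apply the necessitation rules). A set $w$ of formulas is saturated if each finite subset of $w$ is consistent (does not derive $\bot$), for each $\varphi$ either $\varphi\in w$ or $\neg\varphi\in w$, and whenever $\bigcirc^nL_{r_1}\cdots L_{r_k}L_s\varphi\in w$ for all rational $s<r$ then $\bigcirc^nL_{r_1}\cdots L_{r_k}L_r\varphi\in w$. $\Omega_c$ is the set of all saturated sets, and $\tau_c$ is the topology on $\Omega_c$ generated by the sets $[\varphi]=\{w\in\Omega_c\mid\varphi\in w\}$, $\varphi$ a formula. -}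

module Defs where

open import Level using (Level; suc; zero)
open import Data.Nat using (ℕ)
open import Data.Bool using (Bool; true; false; not; _∧_)
open import Data.List using (List; []; _∷_)
open import Data.List.Membership.Propositional using (_∈_)
open import Data.List.Relation.Unary.All using (All)
open import Data.Product using (Σ; _×_; ∃; proj₁)
open import Data.Sum using (_⊎_)
open import Data.Empty using (⊥)
open import Relation.Nullary using (¬_)
open import Relation.Binary.PropositionalEquality using (_≡_)
open import Data.Rational as ℚ using (ℚ; 0ℚ; 1ℚ)

record ℚ01 : Set where
  constructor mkℚ01
  field
    val  : ℚ
    .lo  : 0ℚ ℚ.≤ val
    .hi  : val ℚ.≤ 1ℚ
open ℚ01 public

data Form : Set where
  var  : ℕ → Form
  ¬'   : Form → Form
  _∧'_ : Form → Form → Form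
  L    : ℚ01 → Form → Form
  ○    : Form → Form

infixr 6 _∧'_
infixr 4 _⇒_ _⇔'_

_⇒_ : Form → Form → Form
φ ⇒ ψ = ¬' (φ ∧' ¬' ψ)

_⇔'_ : Form → Form → Form
φ ⇔' ψ = (φ ⇒ ψ) ∧' (ψ ⇒ φ)

⊥' : Form
⊥' = var 0 ∧' ¬' (var 0)

○^ : ℕ → Form → Form
○^ ℕ.zero φ = φ
○^ (ℕ.suc n) φ = ○ (○^ n φ)

Ls : List ℚ01 → Form → Form
Ls [] φ = φ
Ls (r ∷ rs) φ = L r (Ls rs φ)

pattern' : ℕ → List ℚ01 → ℚ01 → Form → Form
pattern' n rs s φ = ○^ n (Ls rs (L s φ))

-- Propositional tautologies: formulas whose principal connectives are
-- not ¬ / ∧ (variables, L_r ψ, ○ ψ) are treated as propositional atoms.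

eval : (Form → Bool) → Form → Bool
eval v (var p)  = v (var p)
eval v (¬' φ)   = not (eval v φ)
eval v (φ ∧' ψ) = eval v φ ∧ eval v ψ
eval v (L r φ)  = v (L r φ)
eval v (○ φ)    = v (○ φ)

Tautology : Form → Set
Tautology φ = (v : Form → Bool) → eval v φ ≡ true

data Axiom : Form → Set where
  taut   : ∀ {φ} → Tautology φ → Axiom φ
  L0⊥    : (z : ℚ01) → val z ≡ 0ℚ → Axiom (L z ⊥')
  Lneg   : ∀ {φ} (r s : ℚ01) → 1ℚ ℚ.< val r ℚ.+ val s →
           Axiom (L r (¬' φ) ⇒ ¬' (L s φ))
  Ladd   : ∀ {φ ψ} (r s t : ℚ01) → val t ≡ val r ℚ.+ val s →
           Axiom ((L r (φ ∧' ψ) ∧' L s (φ ∧' ¬' ψ)) ⇒ L t φ)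
  LaddN  : ∀ {φ ψ} (r s t : ℚ01) → val t ≡ val r ℚ.+ val s →
           Axiom ((¬' (L r (φ ∧' ψ)) ∧' ¬' (L s (φ ∧' ¬' ψ))) ⇒ ¬' (L t φ))
  Lk     : ∀ {φ ψ} (o r : ℚ01) → val o ≡ 1ℚ →
           Axiom (L o (φ ⇒ ψ) ⇒ (L r φ ⇒ L r ψ))
  ○neg   : ∀ {φ} → Axiom (○ (¬' φ) ⇔' ¬' (○ φ))
  ○and   : ∀ {φ ψ} → Axiom (○ (φ ∧' ψ) ⇔' (○ φ ∧' ○ ψ))

-- Theorems (derivations without premises; well-founded, possibly
-- infinitely branching trees = derivations of countable ordinal length)

data Thm : Form → Set where
  ax    : ∀ {φ} → Axiom φ → Thm φ
  mp    : ∀ {φ ψ} → Thm φ → Thm (φ ⇒ ψ) → Thm ψ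
  inf   : ∀ {ψ φ} n rs (r : ℚ01) →
          ((s : ℚ01) → val s ℚ.< val r → Thm (ψ ⇒ pattern' n rs s φ)) →
          Thm (ψ ⇒ pattern' n rs r φ)
  necL  : ∀ {φ} (o : ℚ01) → val o ≡ 1ℚ → Thm φ → Thm (L o φ)
  nec○  : ∀ {φ} → Thm φ → Thm (○ φ)

-- Derivations from a set of premises Γ: the necessitation rules may not
-- be applied (they are only available inside theorems).

data _⊢_ (Γ : Form → Set) : Form → Set where
  thm   : ∀ {φ} → Thm φ → Γ ⊢ φ
  prem  : ∀ {φ} → Γ φ → Γ ⊢ φ
  mp    : ∀ {φ ψ} → Γ ⊢ φ → Γ ⊢ (φ ⇒ ψ) → Γ ⊢ ψ
  inf   : ∀ {ψ φ} n rs (r : ℚ01) →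
          ((s : ℚ01) → val s ℚ.< val r → Γ ⊢ (ψ ⇒ pattern' n rs s φ)) →
          Γ ⊢ (ψ ⇒ pattern' n rs r φ)

Consistent : List Form → Set
Consistent Δ = ¬ ((λ φ → φ ∈ Δ) ⊢ ⊥')

record Saturated (w : Form → Set) : Set₁ where
  field
    finCons  : (Δ : List Form) → All w Δ → Consistent Δ
    complete : (φ : Form) → w φ ⊎ w (¬' φ)
    closed   : ∀ n rs (r : ℚ01) φ →
               ((s : ℚ01) → val s ℚ.< val r → w (pattern' n rs s φ)) →
               w (pattern' n rs r φ)

Ωc : Set₁
Ωc = Σ (Form → Set) Saturated

_∈[_] : Ωc → Form → Set
w ∈[ φ ] = proj₁ w φ

-- A saturated set w is deductively closed with respect to its finite subsets: if
-- Δ ⊆ w derives φ but ¬φ ∈ w, then the finite set ¬φ ∷ Δ ⊆ w is inconsistent.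
-- In particular [φ ∧ ψ] = [φ] ∩ [ψ], so O_i ∩ O_j is the single basic set
-- O_k for the code k of φ_i ∧ φ_j, and g(i, j, k) can ignore its last argument.
module Submission where

open import Defs
open import Data.Nat using (ℕ)
open import Data.Bool using (true; false)
open import Data.List using (_∷_)
open import Data.Empty using (⊥-elim)
open import Data.List.Membership.Propositional using (_∈_)
open import Data.List.Relation.Unary.All using (All; _∷_; [])
open import Data.List.Relation.Unary.Any using (here; there)
open import Data.Product using (Σ; _×_; ∃; _,_; proj₁; proj₂)
open import Data.Sum using (inj₁; inj₂)
open import Function.Bundles using (_↔_; _⇔_; Inverse; Equivalence; mk⇔)
open import Relation.Binary.PropositionalEquality using (_≡_; refl; sym; subst)

taut-explosion : ∀ φ → Tautology (φ ⇒ (¬' φ ⇒ ⊥'))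
taut-explosion φ v with eval v φ | v (var 0)
... | true  | true  = refl
... | true  | false = refl
... | false | _     = refl

taut-∧-intro : ∀ φ ψ → Tautology (φ ⇒ (ψ ⇒ (φ ∧' ψ)))
taut-∧-intro φ ψ v with eval v φ | eval v ψ
... | true  | true  = refl
... | true  | false = refl
... | false | _     = refl

taut-∧-elimˡ : ∀ φ ψ → Tautology ((φ ∧' ψ) ⇒ φ)
taut-∧-elimˡ φ ψ v with eval v φ | eval v ψ
... | true  | true  = refl
... | true  | false = refl
... | false | _     = refl

taut-∧-elimʳ : ∀ φ ψ → Tautology ((φ ∧' ψ) ⇒ ψ)
taut-∧-elimʳ φ ψ v with eval v φ | eval v ψ
... | true  | true  = refl
... | true  | false = refl
... | false | _     = refl

⊢-mono : ∀ {Γ Δ : Form → Set} {φ} → (∀ {ψ} → Γ ψ → Δ ψ) → Γ ⊢ φ → Δ ⊢ φ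
⊢-mono Γ⊆Δ (thm t)        = thm t
⊢-mono Γ⊆Δ (prem p)       = prem (Γ⊆Δ p)
⊢-mono Γ⊆Δ (mp d e)       = mp (⊢-mono Γ⊆Δ d) (⊢-mono Γ⊆Δ e)
⊢-mono Γ⊆Δ (inf n rs r d) = inf n rs r λ s s<r → ⊢-mono Γ⊆Δ (d s s<r)

module _ (w : Ωc) where
  open Saturated (proj₂ w)

  ∈-closed-⊢ : ∀ {Δ φ} → All (w ∈[_]) Δ → (_∈ Δ) ⊢ φ → w ∈[ φ ]
  ∈-closed-⊢ {Δ} {φ} Δ⊆w Δ⊢φ with complete φ
  ... | inj₁ φ∈w  = φ∈w
  ... | inj₂ ¬φ∈w = ⊥-elim (finCons (¬' φ ∷ Δ) (¬φ∈w ∷ Δ⊆w) ¬φ,Δ⊢⊥)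
    where
    ¬φ,Δ⊢⊥ : (_∈ ¬' φ ∷ Δ) ⊢ ⊥'
    ¬φ,Δ⊢⊥ = mp (prem (here refl))
                (mp (⊢-mono there Δ⊢φ) (thm (ax (taut (taut-explosion φ)))))

  ∧-∈ : ∀ φ ψ → (w ∈[ φ ] × w ∈[ ψ ]) ⇔ w ∈[ φ ∧' ψ ]
  ∧-∈ φ ψ = mk⇔ intro
    (λ φ∧ψ∈w → elim (taut-∧-elimˡ φ ψ) φ∧ψ∈w , elim (taut-∧-elimʳ φ ψ) φ∧ψ∈w)
    where
    intro : w ∈[ φ ] × w ∈[ ψ ] → w ∈[ φ ∧' ψ ]
    intro (φ∈w , ψ∈w) = ∈-closed-⊢ (φ∈w ∷ ψ∈w ∷ [])
      (mp (prem (there (here refl)))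
          (mp (prem (here refl)) (thm (ax (taut (taut-∧-intro φ ψ))))))

    elim : ∀ {χ} → Tautology ((φ ∧' ψ) ⇒ χ) → w ∈[ φ ∧' ψ ] → w ∈[ χ ]
    elim t φ∧ψ∈w = ∈-closed-⊢ (φ∧ψ∈w ∷ []) (mp (prem (here refl)) (thm (ax (taut t))))

proposition3p26 : (enum : ℕ ↔ Form) →
    Σ (ℕ → ℕ → ℕ → ℕ) λ g →
      (i j : ℕ) (w : Ωc) →
        ((w ∈[ Inverse.to enum i ]) × (w ∈[ Inverse.to enum j ]))
          ⇔ (∃ λ k → w ∈[ Inverse.to enum (g i j k) ])
proposition3p26 enum = g , λ i j w → mk⇔
    (λ both → 0 , subst (w ∈[_]) (sym (code i j 0)) (Equivalence.to (∧-∈ w (to i) (to j)) both))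
    (λ (k , k∈w) → Equivalence.from (∧-∈ w (to i) (to j)) (subst (w ∈[_]) (code i j k) k∈w))
  where
  open Inverse enum using (to; from; strictlyInverseˡ)

  g : ℕ → ℕ → ℕ → ℕ
  g i j _ = from (to i ∧' to j)

  code : ∀ i j k → to (g i j k) ≡ to i ∧' to j
  code i j _ = strictlyInverseˡ (to i ∧' to j)
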